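{- Let $T$ be a balanced tree. If $T$ has two leaves $l_1,l_2$ with $\mathrm{dist}(l_1,l_2)=4$, then $T$ is not well-totally dominated.
   Context: All graphs are finite and simple. A leaf is a vertex of degree 1; the height of a vertex is its minimum distance to a leaf. A tree is balanced if no two vertices of the same height are adjacent. A total dominating set (TDS) of a graph is a set $S$ of vertices with $N(S)=V$, where $N(S)$ is the union of the open neighborhoods of the vertices of $S$; a minimal TDS is one with no proper subset that is a TDS. A graph is well-totally dominated if all its minimal TDSs have the same size. -}

module Defs where

open import Data.Nat using (ℕ; zero; suc; _≤_; _≥_)
open import Data.Bool using (Bool; true; false)
open import Data.Fin using (Fin)
open import Data.Fin.Subset using (Subset; _∈_; _⊂_; ∣_∣)
open import Data.List using (List; []; _∷_; _++_; length; filterᵇ; allFin)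
open import Data.List.Relation.Unary.Linked using (Linked)
open import Data.List.Relation.Unary.Unique.Propositional using (Unique)
open import Data.Product using (Σ; ∃; _×_; _,_)
open import Relation.Binary.PropositionalEquality using (_≡_)
open import Relation.Nullary using (¬_)

-- A finite simple graph on the vertex set Fin n, given by a Boolean
-- (hence decidable, proof-irrelevant) adjacency relation that is
-- symmetric and irreflexive.
record Graph (n : ℕ) : Set where
  field
    adj    : Fin n → Fin n → Bool
    sym    : ∀ u v → adj u v ≡ adj v u
    irrefl : ∀ u → adj u u ≡ false

module _ {n : ℕ} (G : Graph n) where
  open Graph G

  Adj : Fin n → Fin n → Set
  Adj u v = adj u v ≡ true

  data Walk : Fin n → Fin n → ℕ → Set where
    here  : ∀ {u} → Walk u u 0
    there : ∀ {u v w k} → Adj u v → Walk v w k → Walk u w (suc k)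

  Dist : Fin n → Fin n → ℕ → Set
  Dist u v d = Walk u v d × (∀ k → Walk u v k → d ≤ k)

  Connected : Set
  Connected = ∀ u v → ∃ λ k → Walk u v k

  HasCycle : Set
  HasCycle = Σ (Fin n) λ x → Σ (Fin n) λ y → Σ (List (Fin n)) λ zs →
    (length zs ≥ 1) × Unique (x ∷ zs ++ y ∷ []) ×
    Linked Adj (x ∷ zs ++ y ∷ []) × Adj y x

  IsTree : Set
  IsTree = Connected × ¬ HasCycle

  degree : Fin n → ℕ
  degree u = length (filterᵇ (adj u) (allFin n))

  Leaf : Fin n → Set
  Leaf u = degree u ≡ 1

  Height : Fin n → ℕ → Set
  Height v h = (Σ (Fin n) λ l → Leaf l × Walk v l h) ×
               (∀ l k → Leaf l → Walk v l k → h ≤ k)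

  Balanced : Set
  Balanced = ∀ u v h → Adj u v → Height u h → ¬ Height v h

  IsTDS : Subset n → Set
  IsTDS S = ∀ v → Σ (Fin n) λ u → u ∈ S × Adj u v

  IsMinimalTDS : Subset n → Set
  IsMinimalTDS S = IsTDS S × (∀ S′ → S′ ⊂ S → ¬ IsTDS S′)

  WellTotallyDominated : Set
  WellTotallyDominated = ∀ S S′ → IsMinimalTDS S → IsMinimalTDS S′ → ∣ S ∣ ≡ ∣ S′ ∣

-- Let l₁ a c b l₂ be the path between the two leaves, so a and b have height 1.
-- Let v ∉ {a, b} ∪ N(a) ∪ N(b) have a neighbour w ∈ N(a). Then v is not a leaf
-- (else w would be a second vertex of height 1 next to a), and any other
-- neighbour of v lies outside N(a) ∪ N(b), since otherwise the tree would
-- contain a cycle of length 4 or 6. Hence l₁, l₂ together with the vertices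
-- outside N(a) ∪ N(b) form a TDS, and a minimal TDS S inside it must contain
-- l₁ and l₂, which are the only neighbours of a and b it contains. Replacing
-- l₁ and l₂ by c in S gives a smaller TDS, and a minimal TDS inside that one is
-- smaller than S.

module Submission where

open import Defs
open import Data.Nat using (ℕ; zero; suc; _+_; _≤_; _<_; z≤n; s≤s)
open import Data.Nat.Induction using (<-wellFounded)
open import Data.Nat.Properties
  using (module ≤-Reasoning; ≤-refl; ≤-reflexive; ≤-trans; ≤-antisym; ≤-<-trans; <⇒≱; <-irrefl; m≤n⇒m≤1+n; +-suc; +-comm)
open import Data.Bool using (Bool; true; false) renaming (_≟_ to _≟ᵇ_)
open import Data.Fin using (Fin; zero; suc; _≟_)
open import Data.Fin.Properties using (any?; all?; suc-injective; 0≢1+n)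
open import Data.Fin.Subset using (Subset; _∈_; _⊆_; _⊂_; ∣_∣; _-_; _∪_; ⁅_⁆; inside; outside)
open import Data.Fin.Subset.Properties
  using (_∈?_; x∈p∧x≢y⇒x∈p-y; x∈p⇒∣p-x∣<∣p∣; p⊆q⇒∣p∣≤∣q∣; ∣⁅x⁆∣≡1; x∈p∪q⁺; x∈⁅x⁆; p─q⊆p)
open import Data.List using ([]; _∷_; length; filterᵇ; tabulate)
open import Data.List.Relation.Unary.Linked using ([-]; _∷_)
open import Data.List.Relation.Unary.All using ([]; _∷_)
open import Data.List.Relation.Unary.AllPairs using ([]; _∷_)
open import Data.Product using (∃; _×_; _,_; proj₁; map₁; map₂; swap)
open import Data.Sum using (_⊎_; inj₁; inj₂)
open import Data.Vec as Vec using ([]; _∷_)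
open import Data.Vec.Properties using (lookup∘tabulate; lookup⇒[]=; []=⇒lookup)
open import Data.Empty using (⊥-elim)
open import Function using (_∘_; id)
open import Induction.WellFounded using (Acc; acc)
open import Relation.Binary.PropositionalEquality using (_≡_; _≢_; refl; sym; trans; subst; cong)
open import Relation.Nullary using (¬_; Dec; yes; no; does)
open import Relation.Nullary.Decidable using (_×-dec_; _⊎-dec_; ¬?; dec-true)
open import Relation.Unary using (Pred; Decidable)

module _ {a} {A : Set a} (p : A → Bool) where

  count-∷ : ∀ x xs → length (filterᵇ p xs) ≤ length (filterᵇ p (x ∷ xs))
  count-∷ x xs with p x
  ... | true  = m≤n⇒m≤1+n ≤-refl
  ... | false = ≤-refl

  1≤count : ∀ {m} (g : Fin m → A) i → p (g i) ≡ true → 1 ≤ length (filterᵇ p (tabulate g))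
  1≤count g zero    pgi rewrite pgi = s≤s z≤n
  1≤count g (suc i) pgi = ≤-trans (1≤count (g ∘ suc) i pgi) (count-∷ (g zero) _)

  2≤count : ∀ {m} (g : Fin m → A) {i j} → i ≢ j → p (g i) ≡ true → p (g j) ≡ true →
            2 ≤ length (filterᵇ p (tabulate g))
  2≤count g {zero}  {zero}  i≢j _   _   = ⊥-elim (i≢j refl)
  2≤count g {zero}  {suc j} _   pgi pgj rewrite pgi = s≤s (1≤count (g ∘ suc) j pgj)
  2≤count g {suc i} {zero}  _   pgi pgj rewrite pgj = s≤s (1≤count (g ∘ suc) i pgi)
  2≤count g {suc i} {suc j} i≢j pgi pgj =
    ≤-trans (2≤count (g ∘ suc) (i≢j ∘ cong suc) pgi pgj) (count-∷ (g zero) _)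

  count≡0 : ∀ {m} (g : Fin m → A) → (∀ i → p (g i) ≢ true) → length (filterᵇ p (tabulate g)) ≡ 0
  count≡0 {zero}  g none = refl
  count≡0 {suc m} g none with p (g zero) in pg0
  ... | true  = ⊥-elim (none zero pg0)
  ... | false = count≡0 (g ∘ suc) (none ∘ suc)

  count≤1 : ∀ {m} (g : Fin m → A) → (∀ {i j} → p (g i) ≡ true → p (g j) ≡ true → i ≡ j) →
            length (filterᵇ p (tabulate g)) ≤ 1
  count≤1 {zero}  g unique = z≤n
  count≤1 {suc m} g unique with p (g zero) in pg0
  ... | true  rewrite count≡0 (g ∘ suc) (λ i pgi → 0≢1+n (unique pg0 pgi)) = s≤s z≤n
  ... | false = count≤1 (g ∘ suc) (λ pgi pgj → suc-injective (unique pgi pgj))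

∣p∪q∣≤∣p∣+∣q∣ : ∀ {n} (p q : Subset n) → ∣ p ∪ q ∣ ≤ ∣ p ∣ + ∣ q ∣
∣p∪q∣≤∣p∣+∣q∣ []            []            = z≤n
∣p∪q∣≤∣p∣+∣q∣ (outside ∷ p) (outside ∷ q) = ∣p∪q∣≤∣p∣+∣q∣ p q
∣p∪q∣≤∣p∣+∣q∣ (inside  ∷ p) (outside ∷ q) = s≤s (∣p∪q∣≤∣p∣+∣q∣ p q)
∣p∪q∣≤∣p∣+∣q∣ (outside ∷ p) (inside  ∷ q) rewrite +-suc ∣ p ∣ ∣ q ∣ = s≤s (∣p∪q∣≤∣p∣+∣q∣ p q)
∣p∪q∣≤∣p∣+∣q∣ (inside  ∷ p) (inside  ∷ q) rewrite +-suc ∣ p ∣ ∣ q ∣ =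
  s≤s (m≤n⇒m≤1+n (∣p∪q∣≤∣p∣+∣q∣ p q))

∣p-x-y∪⁅z⁆∣<∣p∣ : ∀ {n} {p : Subset n} {x y} z → x ∈ p → y ∈ p → x ≢ y → ∣ (p - x - y) ∪ ⁅ z ⁆ ∣ < ∣ p ∣
∣p-x-y∪⁅z⁆∣<∣p∣ {p = p} {x} {y} z x∈p y∈p x≢y = begin-strict
  ∣ (p - x - y) ∪ ⁅ z ⁆ ∣      ≤⟨ ∣p∪q∣≤∣p∣+∣q∣ (p - x - y) ⁅ z ⁆ ⟩
  ∣ p - x - y ∣ + ∣ ⁅ z ⁆ ∣  ≡⟨ cong (∣ p - x - y ∣ +_) (∣⁅x⁆∣≡1 z) ⟩
  ∣ p - x - y ∣ + 1          ≡⟨ +-comm ∣ p - x - y ∣ 1 ⟩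
  suc ∣ p - x - y ∣          ≤⟨ x∈p⇒∣p-x∣<∣p∣ (x∈p∧x≢y⇒x∈p-y y∈p (x≢y ∘ sym)) ⟩
  ∣ p - x ∣                  <⟨ x∈p⇒∣p-x∣<∣p∣ x∈p ⟩
  ∣ p ∣                      ∎
  where open ≤-Reasoning

module _ {n ℓ} {P : Pred (Fin n) ℓ} (P? : Decidable P) where

  subset : Subset n
  subset = Vec.tabulate (does ∘ P?)

  ∈-subset⁺ : ∀ {x} → P x → x ∈ subset
  ∈-subset⁺ {x} px = lookup⇒[]= x subset (trans (lookup∘tabulate (does ∘ P?) x) (dec-true (P? x) px))

  ∈-subset⁻ : ∀ {x} → x ∈ subset → P x
  ∈-subset⁻ {x} x∈ with P? x | trans (sym (lookup∘tabulate (does ∘ P?) x)) ([]=⇒lookup x∈)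
  ... | yes px | _  = px
  ... | no _   | ()

Minimal : ∀ {n ℓ} → Pred (Subset n) ℓ → Subset n → Set ℓ
Minimal P S = P S × (∀ S′ → S′ ⊂ S → ¬ P S′)

module _ {n ℓ} {P : Pred (Subset n) ℓ} (P? : Decidable P) (P-mono : ∀ {S T} → P S → S ⊆ T → P T) where

  ∃-minimal-⊆ : ∀ {X} → P X → ∃ λ S → S ⊆ X × Minimal P S
  ∃-minimal-⊆ {X} = go X (<-wellFounded ∣ X ∣)
    where
    go : ∀ X → Acc _<_ ∣ X ∣ → P X → ∃ λ S → S ⊆ X × Minimal P S
    go X (acc rec) pX with any? (λ x → (x ∈? X) ×-dec P? (X - x))
    ... | yes (x , x∈X , pX-x) with go (X - x) (rec (x∈p⇒∣p-x∣<∣p∣ x∈X)) pX-x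
    ...   | S , S⊆X-x , minS = S , p─q⊆p X ⁅ x ⁆ ∘ S⊆X-x , minS
    go X (acc rec) pX | no ¬removable = X , id , pX , minimal
      where
      minimal : ∀ S′ → S′ ⊂ X → ¬ P S′
      minimal S′ (S′⊆X , y , y∈X , y∉S′) pS′ =
        ¬removable (y , y∈X , P-mono pS′ λ z∈S′ → x∈p∧x≢y⇒x∈p-y (S′⊆X z∈S′) λ { refl → y∉S′ z∈S′ })

module GraphProperties {n : ℕ} (G : Graph n) where
  open Graph G using (adj; irrefl)

  Adj? : ∀ u v → Dec (Adj G u v)
  Adj? u v = adj u v ≟ᵇ true

  Adj-sym : ∀ {u v} → Adj G u v → Adj G v u
  Adj-sym {u} {v} = trans (Graph.sym G v u)

  ¬Adj-refl : ∀ {u} → ¬ Adj G u u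
  ¬Adj-refl {u} uu with trans (sym (irrefl u)) uu
  ... | ()

  Adj⇒≢ : ∀ {u v} → Adj G u v → u ≢ v
  Adj⇒≢ uv refl = ¬Adj-refl uv

  leaf-neighbour-unique : ∀ {l u u′} → Leaf G l → Adj G l u → Adj G l u′ → u ≡ u′
  leaf-neighbour-unique {l} {u} {u′} leaf lu lu′ with u ≟ u′
  ... | yes u≡u′ = u≡u′
  ... | no u≢u′ with ≤-trans (2≤count (adj l) id u≢u′ lu lu′) (≤-reflexive leaf)
  ...   | s≤s ()

  two-neighbours⇒¬leaf : ∀ {v u u′} → Adj G v u → Adj G v u′ → u ≢ u′ → ¬ Leaf G v
  two-neighbours⇒¬leaf vu vu′ u≢u′ leaf = u≢u′ (leaf-neighbour-unique leaf vu vu′)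

  ¬leaf⇒other-neighbour : ∀ {v w} → ¬ Leaf G v → Adj G v w → ∃ λ w′ → Adj G v w′ × w′ ≢ w
  ¬leaf⇒other-neighbour {v} {w} ¬leaf vw with any? (λ w′ → Adj? v w′ ×-dec ¬? (w′ ≟ w))
  ... | yes found = found
  ... | no none = ⊥-elim (¬leaf (≤-antisym (count≤1 (adj v) id only-w) (1≤count (adj v) id w vw)))
    where
    is-w : ∀ {u} → Adj G v u → u ≡ w
    is-w {u} vu with u ≟ w
    ... | yes u≡w = u≡w
    ... | no u≢w  = ⊥-elim (none (u , vu , u≢w))
    only-w : ∀ {u u′} → Adj G v u → Adj G v u′ → u ≡ u′
    only-w vu vu′ = trans (is-w vu) (sym (is-w vu′))

  connected⇒has-neighbour : Connected G → ∀ {u v} → u ≢ v → ∃ λ w → Adj G u w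
  connected⇒has-neighbour connected {u} {v} u≢v with connected u v
  ... | zero  , here       = ⊥-elim (u≢v refl)
  ... | suc _ , there uw _ = _ , uw

  support-height : ∀ {x l} → ¬ Leaf G x → Leaf G l → Adj G x l → Height G x 1
  support-height {x} {l} ¬leaf leaf xl = (l , leaf , there xl here) , minimal
    where
    minimal : ∀ l′ k → Leaf G l′ → Walk G x l′ k → 1 ≤ k
    minimal l′ zero    leaf′ here = ⊥-elim (¬leaf leaf′)
    minimal l′ (suc k) leaf′ _    = s≤s z≤n

  hasCycle₄ : ∀ {p₁ p₂ p₃ p₄} →
    p₁ ≢ p₂ → p₁ ≢ p₃ → p₁ ≢ p₄ → p₂ ≢ p₃ → p₂ ≢ p₄ → p₃ ≢ p₄ →
    Adj G p₁ p₂ → Adj G p₂ p₃ → Adj G p₃ p₄ → Adj G p₄ p₁ → HasCycle G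
  hasCycle₄ {p₁} {p₂} {p₃} {p₄} d₁₂ d₁₃ d₁₄ d₂₃ d₂₄ d₃₄ e₁₂ e₂₃ e₃₄ e₄₁ =
    p₁ , p₄ , p₂ ∷ p₃ ∷ [] , s≤s z≤n ,
    ((d₁₂ ∷ d₁₃ ∷ d₁₄ ∷ []) ∷ (d₂₃ ∷ d₂₄ ∷ []) ∷ (d₃₄ ∷ []) ∷ [] ∷ []) ,
    (e₁₂ ∷ e₂₃ ∷ e₃₄ ∷ [-]) , e₄₁

  hasCycle₆ : ∀ {p₁ p₂ p₃ p₄ p₅ p₆} →
    p₁ ≢ p₂ → p₁ ≢ p₃ → p₁ ≢ p₄ → p₁ ≢ p₅ → p₁ ≢ p₆ →
    p₂ ≢ p₃ → p₂ ≢ p₄ → p₂ ≢ p₅ → p₂ ≢ p₆ →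
    p₃ ≢ p₄ → p₃ ≢ p₅ → p₃ ≢ p₆ →
    p₄ ≢ p₅ → p₄ ≢ p₆ →
    p₅ ≢ p₆ →
    Adj G p₁ p₂ → Adj G p₂ p₃ → Adj G p₃ p₄ → Adj G p₄ p₅ → Adj G p₅ p₆ → Adj G p₆ p₁ →
    HasCycle G
  hasCycle₆ {p₁} {p₂} {p₃} {p₄} {p₅} {p₆}
    d₁₂ d₁₃ d₁₄ d₁₅ d₁₆ d₂₃ d₂₄ d₂₅ d₂₆ d₃₄ d₃₅ d₃₆ d₄₅ d₄₆ d₅₆ e₁₂ e₂₃ e₃₄ e₄₅ e₅₆ e₆₁ =
    p₁ , p₆ , p₂ ∷ p₃ ∷ p₄ ∷ p₅ ∷ [] , s≤s z≤n ,
    ((d₁₂ ∷ d₁₃ ∷ d₁₄ ∷ d₁₅ ∷ d₁₆ ∷ []) ∷ (d₂₃ ∷ d₂₄ ∷ d₂₅ ∷ d₂₆ ∷ []) ∷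
     (d₃₄ ∷ d₃₅ ∷ d₃₆ ∷ []) ∷ (d₄₅ ∷ d₄₆ ∷ []) ∷ (d₅₆ ∷ []) ∷ [] ∷ []) ,
    (e₁₂ ∷ e₂₃ ∷ e₃₄ ∷ e₄₅ ∷ e₅₆ ∷ [-]) , e₆₁

  path₄-shortest⇒distinct : ∀ {l₁ a c b l₂} → Adj G l₁ a → Adj G a c → Adj G c b → Adj G b l₂ →
    (∀ k → Walk G l₁ l₂ k → 4 ≤ k) → l₁ ≢ l₂ × l₁ ≢ c × l₂ ≢ c × a ≢ b × ¬ Adj G a b
  path₄-shortest⇒distinct {l₁ = l₁} {l₂ = l₂} l₁a ac cb bl₂ shortest =
    (λ { refl → too-short here (s≤s z≤n) }) ,
    (λ { refl → too-short (there cb (there bl₂ here)) (s≤s (s≤s (s≤s z≤n))) }) ,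
    (λ { refl → too-short (there l₁a (there ac here)) (s≤s (s≤s (s≤s z≤n))) }) ,
    (λ { refl → too-short (there l₁a (there bl₂ here)) (s≤s (s≤s (s≤s z≤n))) }) ,
    (λ ab → too-short (there l₁a (there ab (there bl₂ here))) ≤-refl)
    where
    too-short : ∀ {k} → Walk G l₁ l₂ k → ¬ k < 4
    too-short walk k<4 = <⇒≱ k<4 (shortest _ walk)

  IsTDS? : Decidable (IsTDS G)
  IsTDS? S = all? λ v → any? λ u → (u ∈? S) ×-dec Adj? u v

  IsTDS-mono : ∀ {S T} → IsTDS G S → S ⊆ T → IsTDS G T
  IsTDS-mono tds S⊆T v with tds v
  ... | u , u∈S , uv = u , S⊆T u∈S , uv

  ∃-minimalTDS-⊆ : ∀ {X} → IsTDS G X → ∃ λ S → S ⊆ X × IsMinimalTDS G S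
  ∃-minimalTDS-⊆ = ∃-minimal-⊆ IsTDS? IsTDS-mono

  sole-dominator∈TDS : ∀ {S v l} → IsTDS G S → (∀ {u} → u ∈ S → Adj G u v → u ≡ l) → l ∈ S
  sole-dominator∈TDS {S} {v} tds sole with tds v
  ... | u , u∈S , uv = subst (_∈ S) (sole u∈S uv) u∈S

  smaller-TDS⇒¬wtd : ∀ {S T} → IsMinimalTDS G S → IsTDS G T → ∣ T ∣ < ∣ S ∣ → ¬ WellTotallyDominated G
  smaller-TDS⇒¬wtd {S} minS tdsT ∣T∣<∣S∣ wtd with ∃-minimalTDS-⊆ tdsT
  ... | T′ , T′⊆T , minT′ = <-irrefl (wtd T′ S minT′ minS) (≤-<-trans (p⊆q⇒∣p∣≤∣q∣ T′⊆T) ∣T∣<∣S∣)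

  exchange-leaves-isTDS : ∀ {S l₁ a c b l₂} → IsTDS G S → Leaf G l₁ → Leaf G l₂ →
    Adj G l₁ a → Adj G a c → Adj G c b → Adj G b l₂ → IsTDS G ((S - l₁ - l₂) ∪ ⁅ c ⁆)
  exchange-leaves-isTDS {l₁ = l₁} {c = c} {l₂ = l₂} tds leaf₁ leaf₂ l₁a ac cb bl₂ v with tds v
  ... | u , u∈S , uv with u ≟ l₁ | u ≟ l₂
  ...   | yes refl | _        = c , x∈p∪q⁺ (inj₂ (x∈⁅x⁆ c)) ,
                                subst (Adj G c) (leaf-neighbour-unique leaf₁ l₁a uv) (Adj-sym ac)
  ...   | no _     | yes refl = c , x∈p∪q⁺ (inj₂ (x∈⁅x⁆ c)) ,
                                subst (Adj G c) (leaf-neighbour-unique leaf₂ (Adj-sym bl₂) uv) cb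
  ...   | no u≢l₁  | no u≢l₂  = u , x∈p∪q⁺ (inj₁ (x∈p∧x≢y⇒x∈p-y (x∈p∧x≢y⇒x∈p-y u∈S u≢l₁) u≢l₂)) , uv

  exchange-leaves⇒¬wtd : ∀ {S l₁ a c b l₂} → IsMinimalTDS G S → l₁ ∈ S → l₂ ∈ S → l₁ ≢ l₂ →
    Leaf G l₁ → Leaf G l₂ → Adj G l₁ a → Adj G a c → Adj G c b → Adj G b l₂ → ¬ WellTotallyDominated G
  exchange-leaves⇒¬wtd {c = c} minS@(tds , _) l₁∈S l₂∈S l₁≢l₂ leaf₁ leaf₂ l₁a ac cb bl₂ =
    smaller-TDS⇒¬wtd minS (exchange-leaves-isTDS tds leaf₁ leaf₂ l₁a ac cb bl₂)
                          (∣p-x-y∪⁅z⁆∣<∣p∣ c l₁∈S l₂∈S l₁≢l₂)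

module _ {n : ℕ} (G : Graph n) (acyclic : ¬ HasCycle G) where
  open GraphProperties G

  other-neighbours-outside : ∀ {a c b v w w′} → Adj G a c → Adj G c b → ¬ Adj G a b → a ≢ b →
    v ≢ a → v ≢ b → ¬ Adj G a v → Adj G a w → Adj G v w → Adj G v w′ → w′ ≢ w →
    ¬ Adj G a w′ × ¬ Adj G b w′
  other-neighbours-outside {a} {c} {b} {v} {w} {w′} ac cb a≁b a≢b v≢a v≢b a≁v aw vw vw′ w′≢w =
    a≁w′ , b≁w′
    where
    a≁w′ : ¬ Adj G a w′
    a≁w′ aw′ = acyclic (hasCycle₄ {v} {w} {a} {w′}
      (Adj⇒≢ vw) v≢a (Adj⇒≢ vw′) (Adj⇒≢ (Adj-sym aw)) (w′≢w ∘ sym) (Adj⇒≢ aw′)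
      vw (Adj-sym aw) aw′ (Adj-sym vw′))
    b≁w′ : ¬ Adj G b w′
    b≁w′ bw′ with w ≟ c | w′ ≟ c
    ... | yes refl | _        = acyclic (hasCycle₄ {v} {c} {b} {w′}
      (Adj⇒≢ vw) v≢b (Adj⇒≢ vw′) (Adj⇒≢ cb) (w′≢w ∘ sym) (Adj⇒≢ bw′)
      vw cb bw′ (Adj-sym vw′))
    ... | no _     | yes refl = acyclic (hasCycle₄ {v} {w} {a} {c}
      (Adj⇒≢ vw) v≢a (Adj⇒≢ vw′) (Adj⇒≢ (Adj-sym aw)) (w′≢w ∘ sym) (Adj⇒≢ ac)
      vw (Adj-sym aw) ac (Adj-sym vw′))
    ... | no w≢c   | no w′≢c  = acyclic (hasCycle₆ {v} {w} {a} {c} {b} {w′}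
      (Adj⇒≢ vw) v≢a (λ { refl → a≁v ac }) v≢b (Adj⇒≢ vw′)
      (Adj⇒≢ (Adj-sym aw)) w≢c (λ { refl → a≁b aw }) (w′≢w ∘ sym)
      (Adj⇒≢ ac) a≢b (λ { refl → a≁b (Adj-sym bw′) })
      (Adj⇒≢ cb) (w′≢c ∘ sym)
      (Adj⇒≢ bw′)
      vw (Adj-sym aw) ac cb bw′ (Adj-sym vw′))

module _ {n : ℕ} (G : Graph n) (balanced : Balanced G) where
  open GraphProperties G

  balanced⇒¬leaf-at-distance-2 : ∀ {a w v} → Height G a 1 → Adj G a w → Adj G w v → v ≢ a → ¬ Leaf G v
  balanced⇒¬leaf-at-distance-2 ha aw wv v≢a leaf =
    balanced _ _ 1 aw ha (support-height (two-neighbours⇒¬leaf (Adj-sym aw) wv (v≢a ∘ sym)) leaf wv)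

module BalancedTree {n : ℕ} {G : Graph n} (connected : Connected G) (acyclic : ¬ HasCycle G)
                    (balanced : Balanced G) where
  open GraphProperties G

  outside-neighbour-via-N[a] : ∀ {a c b v w} → Height G a 1 → Adj G a c → Adj G c b → ¬ Adj G a b → a ≢ b →
    v ≢ a → v ≢ b → ¬ Adj G a v → Adj G v w → Adj G a w →
    ∃ λ u → (¬ Adj G a u × ¬ Adj G b u) × Adj G u v
  outside-neighbour-via-N[a] ha ac cb a≁b a≢b v≢a v≢b a≁v vw aw
    with ¬leaf⇒other-neighbour (balanced⇒¬leaf-at-distance-2 G balanced ha aw (Adj-sym vw) v≢a) vw
  ... | w′ , vw′ , w′≢w =
    w′ , other-neighbours-outside G acyclic ac cb a≁b a≢b v≢a v≢b a≁v aw vw vw′ w′≢w , Adj-sym vw′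

  outside-neighbour : ∀ {a c b v} → Height G a 1 → Height G b 1 → Adj G a c → Adj G c b → ¬ Adj G a b → a ≢ b →
    v ≢ a → v ≢ b → ¬ Adj G a v → ¬ Adj G b v →
    ∃ λ u → (¬ Adj G a u × ¬ Adj G b u) × Adj G u v
  outside-neighbour {a} {b = b} ha hb ac cb a≁b a≢b v≢a v≢b a≁v b≁v
    with connected⇒has-neighbour connected v≢a
  ... | w , vw with Adj? a w | Adj? b w
  ...   | yes aw | _      = outside-neighbour-via-N[a] ha ac cb a≁b a≢b v≢a v≢b a≁v vw aw
  ...   | no _   | yes bw = map₂ (map₁ swap) (outside-neighbour-via-N[a] hb (Adj-sym cb) (Adj-sym ac)
                              (a≁b ∘ Adj-sym) (a≢b ∘ sym) v≢b v≢a b≁v vw bw)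
  ...   | no a≁w | no b≁w = w , (a≁w , b≁w) , Adj-sym vw

  leaves-in-minimalTDS : ∀ {l₁ a c b l₂} → Leaf G l₁ → Leaf G l₂ →
    Adj G l₁ a → Adj G a c → Adj G c b → Adj G b l₂ → l₁ ≢ c → l₂ ≢ c → a ≢ b → ¬ Adj G a b →
    ∃ λ S → IsMinimalTDS G S × l₁ ∈ S × l₂ ∈ S
  leaves-in-minimalTDS {l₁} {a} {c} {b} {l₂} leaf₁ leaf₂ l₁a ac cb bl₂ l₁≢c l₂≢c a≢b a≁b =
    let S , S⊆X , minS = ∃-minimalTDS-⊆ X-isTDS
    in S , minS , sole-dominator∈TDS (proj₁ minS) (only-l₁ ∘ S⊆X)
                , sole-dominator∈TDS (proj₁ minS) (only-l₂ ∘ S⊆X)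
    where
    ha : Height G a 1
    ha = support-height (two-neighbours⇒¬leaf (Adj-sym l₁a) ac l₁≢c) leaf₁ (Adj-sym l₁a)
    hb : Height G b 1
    hb = support-height (two-neighbours⇒¬leaf (Adj-sym cb) bl₂ (l₂≢c ∘ sym)) leaf₂ bl₂

    Kept : Fin n → Set
    Kept u = u ≡ l₁ ⊎ u ≡ l₂ ⊎ (¬ Adj G a u × ¬ Adj G b u)

    kept? : Decidable Kept
    kept? u = (u ≟ l₁) ⊎-dec (u ≟ l₂) ⊎-dec (¬? (Adj? a u) ×-dec ¬? (Adj? b u))

    kept-neighbour : ∀ v → ∃ λ u → Kept u × Adj G u v
    kept-neighbour v with v ≟ a | v ≟ b
    ... | yes refl | _        = l₁ , inj₁ refl , l₁a
    ... | no _     | yes refl = l₂ , inj₂ (inj₁ refl) , Adj-sym bl₂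
    ... | no v≢a   | no v≢b with Adj? a v | Adj? b v
    ...   | yes av | _      = a , inj₂ (inj₂ (¬Adj-refl , a≁b ∘ Adj-sym)) , av
    ...   | no _   | yes bv = b , inj₂ (inj₂ (a≁b , ¬Adj-refl)) , bv
    ...   | no a≁v | no b≁v =
      map₂ (map₁ (inj₂ ∘ inj₂)) (outside-neighbour ha hb ac cb a≁b a≢b v≢a v≢b a≁v b≁v)

    X-isTDS : IsTDS G (subset kept?)
    X-isTDS v = map₂ (map₁ (∈-subset⁺ kept?)) (kept-neighbour v)

    only-l₁ : ∀ {u} → u ∈ subset kept? → Adj G u a → u ≡ l₁
    only-l₁ u∈X ua with ∈-subset⁻ kept? u∈X
    ... | inj₁ u≡l₁             = u≡l₁
    ... | inj₂ (inj₁ refl)      = ⊥-elim (a≢b (leaf-neighbour-unique leaf₂ ua (Adj-sym bl₂)))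
    ... | inj₂ (inj₂ (a≁u , _)) = ⊥-elim (a≁u (Adj-sym ua))

    only-l₂ : ∀ {u} → u ∈ subset kept? → Adj G u b → u ≡ l₂
    only-l₂ u∈X ub with ∈-subset⁻ kept? u∈X
    ... | inj₁ refl             = ⊥-elim (a≢b (leaf-neighbour-unique leaf₁ l₁a ub))
    ... | inj₂ (inj₁ u≡l₂)      = u≡l₂
    ... | inj₂ (inj₂ (_ , b≁u)) = ⊥-elim (b≁u (Adj-sym ub))

theorem4p5 : ∀ (n : ℕ) (G : Graph n) → IsTree G → Balanced G →
    ∀ l₁ l₂ → Leaf G l₁ → Leaf G l₂ → Dist G l₁ l₂ 4 →
    ¬ WellTotallyDominated G
theorem4p5 n G (connected , acyclic) balanced l₁ l₂ leaf₁ leaf₂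
           (there l₁a (there ac (there cb (there bl₂ here))) , shortest) =
  let l₁≢l₂ , l₁≢c , l₂≢c , a≢b , a≁b = path₄-shortest⇒distinct l₁a ac cb bl₂ shortest
      S , minS , l₁∈S , l₂∈S = leaves-in-minimalTDS leaf₁ leaf₂ l₁a ac cb bl₂ l₁≢c l₂≢c a≢b a≁b
  in exchange-leaves⇒¬wtd minS l₁∈S l₂∈S l₁≢l₂ leaf₁ leaf₂ l₁a ac cb bl₂
  where
  open GraphProperties G
  open BalancedTree connected acyclic balanced
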